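{- Let $G$ be a connected graph and let $H$ be a connected bipartite graph with at least one edge. Then B wins the gp achievement game on $G\,\square\,H$ after his first move.
   Context: A general position set of a graph $G$ is a set $S\subseteq V(G)$ such that no three vertices of $S$ lie on a common shortest path of $G$. The gp achievement game on a graph: players A and B alternately select vertices, A first; a selection is legal if the vertex has not been selected before and the set of all vertices selected so far (including it) is a general position set. The game ends when no legal move exists, and the player who selected the last vertex wins; "a player wins the game" means that player has a winning strategy. The Cartesian product $G\,\square\,H$ has vertex set $V(G)\times V(H)$, with $(g_1,h_1)$ adjacent to $(g_2,h_2)$ iff either $g_1g_2\in E(G)$ and $h_1=h_2$, or $g_1=g_2$ and $h_1h_2\in E(H)$. -}

module Defs where

open import Data.Nat using (ℕ; zero; suc; _≤_)
open import Data.Fin using (Fin)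
open import Data.Bool using (Bool)
open import Data.Product using (Σ; ∃; _×_; _,_)
open import Data.Sum using (_⊎_)
open import Data.List using (List; []; _∷_)
open import Data.List.Membership.Propositional using (_∈_; _∉_)
open import Relation.Binary.PropositionalEquality using (_≡_; _≢_)
open import Relation.Nullary using (¬_)

record Graph : Set₁ where
  field
    n      : ℕ
    _~_    : Fin n → Fin n → Set
    ~-sym  : ∀ {x y} → x ~ y → y ~ x
    ~-irr  : ∀ {x} → ¬ (x ~ x)
  V : Set
  V = Fin n

open Graph public

module _ {V : Set} (E : V → V → Set) where

  data Walk : V → V → Set where
    [] : ∀ {x} → Walk x x
    _∷_ : ∀ {x y z} → E x y → Walk y z → Walk x z

  length : ∀ {x y} → Walk x y → ℕ
  length [] = zero
  length (_ ∷ w) = suc (length w)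

  data OnWalk (u : V) : ∀ {x y} → Walk x y → Set where
    here-end : OnWalk u {u} {u} []
    here     : ∀ {y z} (e : E u y) (w : Walk y z) → OnWalk u (e ∷ w)
    there    : ∀ {x y z} (e : E x y) {w : Walk y z} → OnWalk u w → OnWalk u (e ∷ w)

  IsShortest : ∀ {x y} → Walk x y → Set
  IsShortest {x} {y} p = ∀ (q : Walk x y) → length p ≤ length q

  OnCommonShortestPath : V → V → V → Set
  OnCommonShortestPath u v w =
    Σ V λ a → Σ V λ b → Σ (Walk a b) λ p →
      IsShortest p × OnWalk u p × OnWalk v p × OnWalk w p

  IsGPSet : List V → Set
  IsGPSet S = ∀ u v w → u ∈ S → v ∈ S → w ∈ S →
    u ≢ v → v ≢ w → u ≢ w → ¬ OnCommonShortestPath u v w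

  Connected : Set
  Connected = ∀ x y → Walk x y

  -- B wins the gp achievement game after his first move:
  -- whatever (legal) first vertex x A selects, B can select a vertex y
  -- legally such that afterwards no legal move remains (so the game ends
  -- with B's move and B wins).
  BWinsAfterFirstMove : Set
  BWinsAfterFirstMove =
    ∀ (x : V) → IsGPSet (x ∷ []) →
      Σ V λ y → (y ∉ x ∷ []) × IsGPSet (y ∷ x ∷ []) ×
        (∀ z → z ∉ y ∷ x ∷ [] → ¬ IsGPSet (z ∷ y ∷ x ∷ []))

Connectedᴳ : Graph → Set
Connectedᴳ G = Connected (_~_ G)

Bipartite : Graph → Set
Bipartite G = Σ (V G → Bool) λ c → ∀ x y → _~_ G x y → c x ≢ c y

HasEdge : Graph → Set
HasEdge G = Σ (V G) λ x → Σ (V G) λ y → _~_ G x y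

_□_ : (G H : Graph) → V G × V H → V G × V H → Set
(G □ H) (g₁ , h₁) (g₂ , h₂) =
  (_~_ G g₁ g₂ × h₁ ≡ h₂) ⊎ (g₁ ≡ g₂ × _~_ H h₁ h₂)

{-# OPTIONS --safe #-}
-- After A selects (g , h), B selects (g , h′) with h′ a neighbour of h.  Every further
-- vertex (g″ , h″) then lies on a common geodesic with both: since H is bipartite, the
-- H-distances from h″ to h and to h′ differ by exactly one, so a geodesic from (g″ , h″)
-- that first moves in the G-coordinate to g and then in the H-coordinate to the nearer
-- of h, h′ extends through the edge hh′ to a geodesic ending at the farther one.
module Submission where

open import Defs
open import Data.Nat using (ℕ; zero; suc; _+_; _≤_; _≤?_; z≤n)
open import Data.Nat.Properties
  using (≤-refl; ≤-trans; ≤-pred; ≤-antisym; ≰⇒>; <-cmp; +-comm; +-mono-≤; +-suc)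
open import Data.Bool using (Bool; not)
open import Data.Bool.Properties using (¬-not)
open import Data.Product using (Σ; _×_; _,_; proj₂)
open import Data.Sum using (_⊎_; inj₁; inj₂)
open import Data.Empty using (⊥; ⊥-elim)
open import Data.List using ([]; _∷_)
open import Data.List.Relation.Unary.Any using (here; there)
open import Data.List.Membership.Propositional using (_∉_)
open import Relation.Binary.Definitions using (tri<; tri≈; tri>)
open import Relation.Binary.PropositionalEquality
  using (_≡_; _≢_; refl; sym; trans; cong; subst; ≢-sym; module ≡-Reasoning)
open import Relation.Nullary using (¬_; yes; no)

private
  variable
    A B : Set

module _ (E : A → A → Set) where

  infixr 5 _++ʷ_
  _++ʷ_ : ∀ {x y z} → Walk E x y → Walk E y z → Walk E x z
  [] ++ʷ w = w
  (e ∷ v) ++ʷ w = e ∷ (v ++ʷ w)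

  _∷ʳ_ : ∀ {x y z} → Walk E x y → E y z → Walk E x z
  w ∷ʳ e = w ++ʷ (e ∷ [])

  length-++ʷ : ∀ {x y z} (v : Walk E x y) (w : Walk E y z) →
    length E (v ++ʷ w) ≡ length E v + length E w
  length-++ʷ [] w = refl
  length-++ʷ (e ∷ v) w = cong suc (length-++ʷ v w)

  length-∷ʳ : ∀ {x y z} (w : Walk E x y) (e : E y z) →
    length E (w ∷ʳ e) ≡ suc (length E w)
  length-∷ʳ w e = trans (length-++ʷ w (e ∷ [])) (+-comm (length E w) 1)

  onWalk-start : ∀ {x y} (w : Walk E x y) → OnWalk E x w
  onWalk-start [] = here-end
  onWalk-start (e ∷ w) = here e w

  onWalk-end : ∀ {x y} (w : Walk E x y) → OnWalk E y w
  onWalk-end [] = here-end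
  onWalk-end (e ∷ w) = there e (onWalk-end w)

  onWalk-++ʷʳ : ∀ {u x y z} (v : Walk E x y) {w : Walk E y z} →
    OnWalk E u w → OnWalk E u (v ++ʷ w)
  onWalk-++ʷʳ [] o = o
  onWalk-++ʷʳ (e ∷ v) o = there e (onWalk-++ʷʳ v o)

  shortest-respects-length : ∀ {x y} {p q : Walk E x y} →
    IsShortest E q → length E p ≡ length E q → IsShortest E p
  shortest-respects-length q-shortest eq r = subst (_≤ length E r) (sym eq) (q-shortest r)

  shortest-≤-suc : ∀ {x y z} {q : Walk E x z} → IsShortest E q →
    (p : Walk E x y) (e : E y z) → length E q ≤ suc (length E p)
  shortest-≤-suc q-shortest p e = subst (_ ≤_) (length-∷ʳ p e) (q-shortest (p ∷ʳ e))

  -- Minimality quantifies over all walks, so constructively a shortest walk exists only up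
  -- to double negation; that suffices, as it is only used to refute general position.
  shortest-walk : ∀ {x y} → Walk E x y → ¬ ¬ Σ (Walk E x y) (IsShortest E)
  shortest-walk w = below (length E w) w ≤-refl
    where
    below : ∀ k {x y} (w : Walk E x y) → length E w ≤ k →
      ¬ ¬ Σ (Walk E x y) (IsShortest E)
    below zero w w≤0 none = none (w , λ q → ≤-trans w≤0 z≤n)
    below (suc k) w w≤k none = none (w , minimal)
      where
      minimal : ∀ q → length E w ≤ length E q
      minimal q with length E w ≤? length E q
      ... | yes w≤q = w≤q
      ... | no w≰q = ⊥-elim (below k q (≤-pred (≤-trans (≰⇒> w≰q) w≤k)) none)

  onCommonShortestPath-swap : ∀ {u v w} →
    OnCommonShortestPath E u v w → OnCommonShortestPath E u w v
  onCommonShortestPath-swap (a , b , p , p-shortest , u∈p , v∈p , w∈p) =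
    a , b , p , p-shortest , u∈p , w∈p , v∈p

  pair-isGPSet : ∀ {a b} → IsGPSet E (a ∷ b ∷ [])
  pair-isGPSet _ _ _ (here refl) (here refl) _ u≢v _ _ _ = u≢v refl
  pair-isGPSet _ _ _ (there (here refl)) (there (here refl)) _ u≢v _ _ _ = u≢v refl
  pair-isGPSet _ _ _ (here refl) (there (here refl)) (here refl) _ _ u≢w _ = u≢w refl
  pair-isGPSet _ _ _ (here refl) (there (here refl)) (there (here refl)) _ v≢w _ _ = v≢w refl
  pair-isGPSet _ _ _ (there (here refl)) (here refl) (here refl) _ v≢w _ _ = v≢w refl
  pair-isGPSet _ _ _ (there (here refl)) (here refl) (there (here refl)) _ _ u≢w _ = u≢w refl

  reply-to-collinear-ends-game : ∀ {x y} → x ≢ y →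
    (∀ z → ¬ ¬ OnCommonShortestPath E z x y) →
    (y ∉ x ∷ []) × IsGPSet E (y ∷ x ∷ []) ×
      (∀ z → z ∉ y ∷ x ∷ [] → ¬ IsGPSet E (z ∷ y ∷ x ∷ []))
  reply-to-collinear-ends-game {x} {y} x≢y collinear =
    (λ { (here y≡x) → x≢y (sym y≡x) }) , pair-isGPSet , ends
    where
    ends : ∀ z → z ∉ y ∷ x ∷ [] → ¬ IsGPSet E (z ∷ y ∷ x ∷ [])
    ends z z∉ gp = collinear z (gp z x y
      (here refl) (there (there (here refl))) (there (here refl))
      (λ z≡x → z∉ (there (here z≡x))) x≢y (λ z≡y → z∉ (here z≡y)))

module _ {E : A → A → Set} {F : B → B → Set}
         (f : A → B) (f-edge : ∀ {x y} → E x y → F (f x) (f y)) where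

  mapʷ : ∀ {x y} → Walk E x y → Walk F (f x) (f y)
  mapʷ [] = []
  mapʷ (e ∷ w) = f-edge e ∷ mapʷ w

  length-mapʷ : ∀ {x y} (w : Walk E x y) → length F (mapʷ w) ≡ length E w
  length-mapʷ [] = refl
  length-mapʷ (e ∷ w) = cong suc (length-mapʷ w)

  onWalk-mapʷ : ∀ {u x y} {w : Walk E x y} → OnWalk E u w → OnWalk F (f u) (mapʷ w)
  onWalk-mapʷ here-end = here-end
  onWalk-mapʷ (here e w) = here (f-edge e) (mapʷ w)
  onWalk-mapʷ (there e o) = there (f-edge e) (onWalk-mapʷ o)

module _ {E : A → A → Set} (colour : A → Bool)
         (proper : ∀ x y → E x y → colour x ≢ colour y) where

  flips : ℕ → Bool → Bool
  flips zero b = b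
  flips (suc n) b = flips n (not b)

  colour-along-walk : ∀ {x y} (w : Walk E x y) → colour y ≡ flips (length E w) (colour x)
  colour-along-walk [] = refl
  colour-along-walk {x} (e ∷ w) =
    trans (colour-along-walk w) (cong (flips (length E w)) (¬-not (≢-sym (proper x _ e))))

  walks-to-adjacent-lengths-≢ : ∀ {x y z} (p : Walk E x y) (q : Walk E x z) → E y z →
    length E p ≢ length E q
  walks-to-adjacent-lengths-≢ {x} {y} {z} p q e p≡q = proper y z e (begin
    colour y                          ≡⟨ colour-along-walk p ⟩
    flips (length E p) (colour x)     ≡⟨ cong (λ n → flips n (colour x)) p≡q ⟩
    flips (length E q) (colour x)     ≡⟨ sym (colour-along-walk q) ⟩
    colour z                          ∎)
    where open ≡-Reasoning

  shortest-to-adjacent : (E-sym : ∀ {x y} → E x y → E y x) →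
    ∀ {x y z} {p : Walk E x y} {q : Walk E x z} →
    IsShortest E p → IsShortest E q → E y z →
    length E q ≡ suc (length E p) ⊎ length E p ≡ suc (length E q)
  shortest-to-adjacent E-sym {p = p} {q} p-shortest q-shortest e
    with <-cmp (length E p) (length E q)
  ... | tri< p<q _ _ = inj₁ (≤-antisym (shortest-≤-suc E q-shortest p e) p<q)
  ... | tri≈ _ p≡q _ = ⊥-elim (walks-to-adjacent-lengths-≢ p q e p≡q)
  ... | tri> _ _ q<p = inj₂ (≤-antisym (shortest-≤-suc E p-shortest q (E-sym e)) q<p)

module Product (G H : Graph) where

  _~ᴳ_ : V G → V G → Set
  _~ᴳ_ = _~_ G

  _~ᴴ_ : V H → V H → Set
  _~ᴴ_ = _~_ H

  walkᴳ : ∀ {g₁ g₂} → Walk _~ᴳ_ g₁ g₂ → (h : V H) →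
    Walk (G □ H) (g₁ , h) (g₂ , h)
  walkᴳ w h = mapʷ (_, h) (λ e → inj₁ (e , refl)) w

  walkᴴ : ∀ {h₁ h₂} → (g : V G) → Walk _~ᴴ_ h₁ h₂ →
    Walk (G □ H) (g , h₁) (g , h₂)
  walkᴴ g w = mapʷ (g ,_) (λ e → inj₂ (refl , e)) w

  project : ∀ {g₁ h₁ g₂ h₂} (w : Walk (G □ H) (g₁ , h₁) (g₂ , h₂)) →
    Σ (Walk _~ᴳ_ g₁ g₂) λ u → Σ (Walk _~ᴴ_ h₁ h₂) λ v →
      length _~ᴳ_ u + length _~ᴴ_ v ≡ length (G □ H) w
  project [] = [] , [] , refl
  project (inj₁ (e , refl) ∷ w) with project w
  ... | u , v , eq = e ∷ u , v , cong suc eq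
  project (inj₂ (refl , e) ∷ w) with project w
  ... | u , v , eq = u , e ∷ v , trans (+-suc _ _) (cong suc eq)

  shortest-walkᴳ++walkᴴ : ∀ {g₁ g₂ h₁ h₂}
    {u : Walk _~ᴳ_ g₁ g₂} {v : Walk _~ᴴ_ h₁ h₂} →
    IsShortest _~ᴳ_ u → IsShortest _~ᴴ_ v →
    IsShortest (G □ H) (_++ʷ_ (G □ H) (walkᴳ u h₁) (walkᴴ g₂ v))
  shortest-walkᴳ++walkᴴ {g₂ = g₂} {h₁} {u = u} {v} u-shortest v-shortest w
    with project w
  ... | u′ , v′ , eq = subst (_≤ length (G □ H) w) (sym length-path)
    (subst (_ ≤_) eq (+-mono-≤ (u-shortest u′) (v-shortest v′)))
    where
    open ≡-Reasoning
    length-path : length (G □ H) (_++ʷ_ (G □ H) (walkᴳ u h₁) (walkᴴ g₂ v))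
                ≡ length _~ᴳ_ u + length _~ᴴ_ v
    length-path = begin
      length (G □ H) (_++ʷ_ (G □ H) (walkᴳ u h₁) (walkᴴ g₂ v))
        ≡⟨ length-++ʷ (G □ H) (walkᴳ u h₁) (walkᴴ g₂ v) ⟩
      length (G □ H) (walkᴳ u h₁) + length (G □ H) (walkᴴ g₂ v)
        ≡⟨ cong (_+ length (G □ H) (walkᴴ g₂ v)) (length-mapʷ _ _ u) ⟩
      length _~ᴳ_ u + length (G □ H) (walkᴴ g₂ v)
        ≡⟨ cong (length _~ᴳ_ u +_) (length-mapʷ _ _ v) ⟩
      length _~ᴳ_ u + length _~ᴴ_ v ∎

  collinear-through-edge : ∀ {g₁ g h₁ h h′} {u : Walk _~ᴳ_ g₁ g} (v : Walk _~ᴴ_ h₁ h)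
    (e : h ~ᴴ h′) → IsShortest _~ᴳ_ u → IsShortest _~ᴴ_ (_∷ʳ_ _~ᴴ_ v e) →
    OnCommonShortestPath (G □ H) (g₁ , h₁) (g , h) (g , h′)
  collinear-through-edge {g₁} {g} {h₁} {h′ = h′} {u} v e u-shortest ve-shortest =
    _ , _ , path , shortest-walkᴳ++walkᴴ u-shortest ve-shortest ,
    onWalk-start (G □ H) path ,
    onWalk-++ʷʳ (G □ H) (walkᴳ u h₁)
      (onWalk-mapʷ _ _ (onWalk-++ʷʳ _~ᴴ_ v (here e []))) ,
    onWalk-end (G □ H) path
    where
    path : Walk (G □ H) (g₁ , h₁) (g , h′)
    path = _++ʷ_ (G □ H) (walkᴳ u h₁) (walkᴴ g (_∷ʳ_ _~ᴴ_ v e))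

  collinear-with-edge : Connectedᴳ G → Connectedᴳ H →
    (colour : V H → Bool) → (∀ x y → x ~ᴴ y → colour x ≢ colour y) →
    ∀ z g {h h′} → h ~ᴴ h′ → ¬ ¬ OnCommonShortestPath (G □ H) z (g , h) (g , h′)
  collinear-with-edge G-connected H-connected colour proper (g₁ , h₁) g {h} {h′} e
                      not-collinear =
    shortest-walk _~ᴳ_ (G-connected g₁ g) λ (u , u-shortest) →
    shortest-walk _~ᴴ_ (H-connected h₁ h) λ (v , v-shortest) →
    shortest-walk _~ᴴ_ (H-connected h₁ h′) λ (v′ , v′-shortest) →
    not-collinear (through u-shortest v-shortest v′-shortest
      (shortest-to-adjacent colour proper (~-sym H) v-shortest v′-shortest e))
    where
    through : ∀ {u : Walk _~ᴳ_ g₁ g} {v : Walk _~ᴴ_ h₁ h} {v′ : Walk _~ᴴ_ h₁ h′} →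
      IsShortest _~ᴳ_ u → IsShortest _~ᴴ_ v → IsShortest _~ᴴ_ v′ →
      length _~ᴴ_ v′ ≡ suc (length _~ᴴ_ v) ⊎ length _~ᴴ_ v ≡ suc (length _~ᴴ_ v′) →
      OnCommonShortestPath (G □ H) (g₁ , h₁) (g , h) (g , h′)
    through {v = v} u-shortest _ v′-shortest (inj₁ one-further) =
      collinear-through-edge v e u-shortest
        (shortest-respects-length _~ᴴ_ v′-shortest
          (trans (length-∷ʳ _~ᴴ_ v e) (sym one-further)))
    through {v′ = v′} u-shortest v-shortest _ (inj₂ one-further) =
      onCommonShortestPath-swap (G □ H)
        (collinear-through-edge v′ (~-sym H e) u-shortest
          (shortest-respects-length _~ᴴ_ v-shortest
            (trans (length-∷ʳ _~ᴴ_ v′ (~-sym H e)) (sym one-further))))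

neighbour : (H : Graph) → Connectedᴳ H → HasEdge H → ∀ h → Σ (V H) (_~_ H h)
neighbour H H-connected (a , b , a~b) h with H-connected h a
... | [] = b , a~b
... | e ∷ _ = _ , e

theorem3p5 : (G H : Graph) → Connectedᴳ G → Connectedᴳ H → Bipartite H → HasEdge H →
    BWinsAfterFirstMove (G □ H)
theorem3p5 G H G-connected H-connected (colour , proper) has-edge (g , h) _ =
  let h′ , h~h′ = neighbour H H-connected has-edge h
  in (g , h′) , reply-to-collinear-ends-game (G □ H)
       (λ eq → ~-irr H (subst (_~_ H h) (sym (cong proj₂ eq)) h~h′))
       (λ z → collinear-with-edge G-connected H-connected colour proper z g h~h′)
  where open Product G H
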